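{- For every $\mathcal L_{\mathsf{ID}}$-formula $\psi$: if $\mathsf{ID}_1\vdash\psi$, then $\Pi^1_1\text{ - }\mathsf{CA}_0^-+\{\operatorname{LF}_\varphi(Y_\varphi)\mid I_\varphi\text{ occurs in }\psi\}\vdash\psi^\star$.
   Context: Formulas are in negation normal form (built from literals by $\land,\lor,\forall,\exists$; $\neg$ and $\to$ are abbreviations via de Morgan laws). $\mathcal L_{\mathsf{PA}}^X$ is the language of first order arithmetic with an extra unary predicate $X$. An operator form is an $\mathcal L^X_{\mathsf{PA}}$-formula $\varphi(x,X)$ with a single free number variable $x$ and no subformula of the form $\neg Xt$. $\mathcal L_{\mathsf{ID}}$ extends $\mathcal L_{\mathsf{PA}}$ by a unary predicate $I_\varphi$ for each operator form $\varphi$; $\varphi(x,\psi)$ denotes the result of replacing each $Xt$ in $\varphi$ by $\psi(t)$, and $\varphi(x,I_\varphi)$ that of replacing $Xt$ by $I_\varphi t$. $\mathsf{ID}_1$ is the $\mathcal L_{\mathsf{ID}}$-theory consisting of Peano arithmetic with equality and induction axioms for all $\mathcal L_{\mathsf{ID}}$-formulas, plus the schemata (F) $\forall x(\varphi(x,I_\varphi)\to I_\varphi x)$ and (L) $\forall x(\varphi(x,\psi)\to\psi(x))\to\forall x(I_\varphi x\to\psi(x))$ for operator forms $\varphi$ and $\mathcal L_{\mathsf{ID}}$-formulas $\psi$. $\Pi^1_1\text{ - }\mathsf{CA}_0^-$ is $\mathsf{ACA}_0$ plus comprehension for all $\Pi^1_1$-formulas without free set variables (number parameters allowed). Viewing $X$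 as a set variable, operator forms are $\mathcal L_2$-formulas; $\operatorname{Cl}_\varphi(X):=\forall x\in\mathbb N(\varphi(x,X)\to x\in X)$ and $\operatorname{LF}_\varphi(Y):=\forall x\in\mathbb N\,(x\in Y\leftrightarrow\forall X\subseteq\mathbb N(\operatorname{Cl}_\varphi(X)\to x\in X))$. To each operator form $\varphi$ a fixed set variable $Y_\varphi$ is associated, and $\psi^\star$ is obtained from an $\mathcal L_{\mathsf{ID}}$-formula $\psi$ by replacing each $I_\varphi t$ by $t\in Y_\varphi$. -}

module Defs where

open import Data.Nat using (ℕ; zero; suc; _+_; _<ᵇ_)
open import Data.Bool using (Bool; true; false; T; _∧_)
open import Data.Unit using (⊤; tt)
open import Data.Product using (Σ; _,_; proj₁)
open import Data.List using (List; []; _∷_; map)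
open import Data.List.Membership.Propositional using (_∈_)

-- Syntax.  Number variables and (bound/free) set variables are de Bruijn
-- indices.  Terms of L_PA: variables, 0, S, +, ·.

data Tm : Set where
  tvar : ℕ → Tm
  tzero : Tm
  tsuc : Tm → Tm
  tadd tmul : Tm → Tm → Tm

-- Formulas in negation normal form over a set P of unary "constant"
-- predicate symbols.  The Bool index says whether set variables and set
-- quantifiers (the second-order part) are available.
--   * L_PA^X       = Fm ⊤ false        (pos tt t is  X t)
--   * L_ID         = Fm OpForm false   (pos φ t  is  I_φ t)
--   * L_2 (with the fixed set variables Y_φ)
--                  = Fm OpForm true    (pos φ t  is  t ∈ Y_φ,
--                                       mem i t  is  t ∈ X_i)
data Fm (P : Set) : Bool → Set where
  eq neq : ∀ {b} → Tm → Tm → Fm P b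
  pos neg : ∀ {b} → P → Tm → Fm P b
  mem nmem : ℕ → Tm → Fm P true
  and or : ∀ {b} → Fm P b → Fm P b → Fm P b
  all ex : ∀ {b} → Fm P b → Fm P b
  all² ex² : Fm P true → Fm P true

~_ : ∀ {P b} → Fm P b → Fm P b
~ eq s t = neq s t
~ neq s t = eq s t
~ pos p t = neg p t
~ neg p t = pos p t
~ mem i t = nmem i t
~ nmem i t = mem i t
~ and A B = or (~ A) (~ B)
~ or A B = and (~ A) (~ B)
~ all A = ex (~ A)
~ ex A = all (~ A)
~ all² A = ex² (~ A)
~ ex² A = all² (~ A)

Sub : Set
Sub = ℕ → Tm

tsub : Sub → Tm → Tm
tsub σ (tvar i) = σ i
tsub σ tzero = tzero
tsub σ (tsuc t) = tsuc (tsub σ t)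
tsub σ (tadd s t) = tadd (tsub σ s) (tsub σ t)
tsub σ (tmul s t) = tmul (tsub σ s) (tsub σ t)

_∷ₛ_ : Tm → Sub → Sub
(t ∷ₛ σ) zero = t
(t ∷ₛ σ) (suc i) = σ i

liftS : Sub → Sub
liftS σ = tvar 0 ∷ₛ (λ i → tsub (λ j → tvar (suc j)) (σ i))

fsub : ∀ {P b} → Sub → Fm P b → Fm P b
fsub σ (eq s t) = eq (tsub σ s) (tsub σ t)
fsub σ (neq s t) = neq (tsub σ s) (tsub σ t)
fsub σ (pos p t) = pos p (tsub σ t)
fsub σ (neg p t) = neg p (tsub σ t)
fsub σ (mem i t) = mem i (tsub σ t)
fsub σ (nmem i t) = nmem i (tsub σ t)
fsub σ (and A B) = and (fsub σ A) (fsub σ B)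
fsub σ (or A B) = or (fsub σ A) (fsub σ B)
fsub σ (all A) = all (fsub (liftS σ) A)
fsub σ (ex A) = ex (fsub (liftS σ) A)
fsub σ (all² A) = all² (fsub σ A)
fsub σ (ex² A) = ex² (fsub σ A)

shift : ∀ {P b} → Fm P b → Fm P b
shift = fsub (λ i → tvar (suc i))

sub0 : ∀ {P b} → Fm P b → Tm → Fm P b
sub0 A t = fsub (t ∷ₛ tvar) A

-- Set-variable substitution (set variables: de Bruijn sv i, or a fixed Y)

data SV (P : Set) : Set where
  sv : ℕ → SV P
  sc : P → SV P

shiftSV : ∀ {P} → SV P → SV P
shiftSV (sv j) = sv (suc j)
shiftSV (sc p) = sc p

SSub : Set → Set
SSub P = ℕ → SV P

liftSS : ∀ {P} → SSub P → SSub P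
liftSS τ zero = sv 0
liftSS τ (suc i) = shiftSV (τ i)

memSV : ∀ {P} → SV P → Tm → Fm P true
memSV (sv j) t = mem j t
memSV (sc p) t = pos p t

nmemSV : ∀ {P} → SV P → Tm → Fm P true
nmemSV (sv j) t = nmem j t
nmemSV (sc p) t = neg p t

ssub : ∀ {P} → SSub P → Fm P true → Fm P true
ssub τ (eq s t) = eq s t
ssub τ (neq s t) = neq s t
ssub τ (pos p t) = pos p t
ssub τ (neg p t) = neg p t
ssub τ (mem i t) = memSV (τ i) t
ssub τ (nmem i t) = nmemSV (τ i) t
ssub τ (and A B) = and (ssub τ A) (ssub τ B)
ssub τ (or A B) = or (ssub τ A) (ssub τ B)
ssub τ (all A) = all (ssub τ A)
ssub τ (ex A) = ex (ssub τ A)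
ssub τ (all² A) = all² (ssub (liftSS τ) A)
ssub τ (ex² A) = ex² (ssub (liftSS τ) A)

shift² : ∀ {P} → Fm P true → Fm P true
shift² = ssub (λ i → sv (suc i))

sub0² : ∀ {P} → Fm P true → SV P → Fm P true
sub0² A V = ssub (λ { zero → V ; (suc i) → sv i }) A

-- Tait-style sequent calculus (with cut) for classical (two-sorted)
-- first-order logic, relative to a theory T (a predicate on formulas).
-- Der b T Γ : the disjunction of Γ is derivable from axioms in T.
-- T ⊢ A is  Der b T (A ∷ []).

data Der {P : Set} : (b : Bool) → (Fm P b → Set) → List (Fm P b) → Set₁ where
  axm : ∀ {b T Γ A} → A ∈ Γ → ~ A ∈ Γ → Der b T Γ
  thy : ∀ {b T Γ A} → T A → A ∈ Γ → Der b T Γ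
  andR : ∀ {b T Γ A B} → and A B ∈ Γ → Der b T (A ∷ Γ) → Der b T (B ∷ Γ) → Der b T Γ
  orR : ∀ {b T Γ A B} → or A B ∈ Γ → Der b T (A ∷ B ∷ Γ) → Der b T Γ
  allR : ∀ {b T Γ A} → all A ∈ Γ → Der b T (A ∷ map shift Γ) → Der b T Γ
  exR : ∀ {b T Γ A} → ex A ∈ Γ → (t : Tm) → Der b T (sub0 A t ∷ Γ) → Der b T Γ
  all²R : ∀ {T Γ A} → all² A ∈ Γ → Der true T (A ∷ map shift² Γ) → Der true T Γ
  ex²R : ∀ {T Γ A} → ex² A ∈ Γ → (V : SV P) → Der true T (sub0² A V ∷ Γ) → Der true T Γ
  cut : ∀ {b T Γ} (A : Fm P b) → Der b T (A ∷ Γ) → Der b T (~ A ∷ Γ) → Der b T Γ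

v0 v1 : Tm
v0 = tvar 0
v1 = tvar 1

data EqAx {P : Set} {b : Bool} : Fm P b → Set where
  eq-refl : EqAx (all (eq v0 v0))
  eq-subst : (A : Fm P b) →
    EqAx (all (all (or (neq v1 v0)
      (or (~ fsub (v1 ∷ₛ (λ i → tvar (suc (suc i)))) A)
          (fsub (v0 ∷ₛ (λ i → tvar (suc (suc i)))) A)))))

data PABasic {P : Set} {b : Bool} : Fm P b → Set where
  pa1 : PABasic (all (neq (tsuc v0) tzero))
  pa2 : PABasic (all (all (or (neq (tsuc v1) (tsuc v0)) (eq v1 v0))))
  pa3 : PABasic (all (eq (tadd v0 tzero) v0))
  pa4 : PABasic (all (all (eq (tadd v1 (tsuc v0)) (tsuc (tadd v1 v0)))))
  pa5 : PABasic (all (eq (tmul v0 tzero) tzero))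
  pa6 : PABasic (all (all (eq (tmul v1 (tsuc v0)) (tadd (tmul v1 v0) v1))))

-- induction schema for all formulas of the language
-- (A has the induction variable as number variable 0; others are parameters)
data IndAx {P : Set} {b : Bool} : Fm P b → Set where
  ind : (A : Fm P b) →
    IndAx (or (~ sub0 A tzero)
              (or (ex (and A (~ fsub (tsuc v0 ∷ₛ (λ i → tvar (suc i))) A)))
                  (all A)))

tmBelow : ℕ → Tm → Bool
tmBelow k (tvar i) = i <ᵇ k
tmBelow k tzero = true
tmBelow k (tsuc t) = tmBelow k t
tmBelow k (tadd s t) = tmBelow k s ∧ tmBelow k t
tmBelow k (tmul s t) = tmBelow k s ∧ tmBelow k t

fmBelow : ∀ {P b} → ℕ → Fm P b → Bool
fmBelow k (eq s t) = tmBelow k s ∧ tmBelow k t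
fmBelow k (neq s t) = tmBelow k s ∧ tmBelow k t
fmBelow k (pos p t) = tmBelow k t
fmBelow k (neg p t) = tmBelow k t
fmBelow k (mem i t) = tmBelow k t
fmBelow k (nmem i t) = tmBelow k t
fmBelow k (and A B) = fmBelow k A ∧ fmBelow k B
fmBelow k (or A B) = fmBelow k A ∧ fmBelow k B
fmBelow k (all A) = fmBelow (suc k) A
fmBelow k (ex A) = fmBelow (suc k) A
fmBelow k (all² A) = fmBelow k A
fmBelow k (ex² A) = fmBelow k A

positive : Fm ⊤ false → Bool
positive (eq s t) = true
positive (neq s t) = true
positive (pos p t) = true
positive (neg p t) = false
positive (and A B) = positive A ∧ positive B
positive (or A B) = positive A ∧ positive B
positive (all A) = positive A
positive (ex A) = positive A

OpForm : Set
OpForm = Σ (Fm ⊤ false) (λ φ → T (positive φ ∧ fmBelow 1 φ))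

toI : OpForm → Fm ⊤ false → Fm OpForm false
toI q (eq s t) = eq s t
toI q (neq s t) = neq s t
toI q (pos _ t) = pos q t
toI q (neg _ t) = neg q t
toI q (and A B) = and (toI q A) (toI q B)
toI q (or A B) = or (toI q A) (toI q B)
toI q (all A) = all (toI q A)
toI q (ex A) = ex (toI q A)

-- plug k φ ψ : φ(x, ψ) at binder depth k, where ψ has its distinguished
-- variable as number variable 0 and parameters as variables 1, 2, ...
-- (relative to the position where plugging starts, depth 0).
plug : ∀ {P b} → ℕ → Fm ⊤ false → Fm P b → Fm P b
plug k (eq s t) ψ = eq s t
plug k (neq s t) ψ = neq s t
plug k (pos _ t) ψ = fsub (t ∷ₛ (λ i → tvar (suc (i + k)))) ψ
plug k (neg _ t) ψ = ~ fsub (t ∷ₛ (λ i → tvar (suc (i + k)))) ψ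
plug k (and A B) ψ = and (plug k A ψ) (plug k B ψ)
plug k (or A B) ψ = or (plug k A ψ) (plug k B ψ)
plug k (all A) ψ = all (plug (suc k) A ψ)
plug k (ex A) ψ = ex (plug (suc k) A ψ)

data ID1Ax : Fm OpForm false → Set where
  id-eq : ∀ {A} → EqAx A → ID1Ax A
  id-pa : ∀ {A} → PABasic A → ID1Ax A
  id-ind : ∀ {A} → IndAx A → ID1Ax A
  id-F : (q : OpForm) → ID1Ax (all (or (~ toI q (proj₁ q)) (pos q v0)))
  id-L : (q : OpForm) (ψ : Fm OpForm false) →
    ID1Ax (or (~ all (or (~ plug 0 (proj₁ q) ψ) ψ)) (all (or (neg q v0) ψ)))

-- ψ⋆ : replace I_φ t by t ∈ Y_φ
star : Fm OpForm false → Fm OpForm true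
star (eq s t) = eq s t
star (neq s t) = neq s t
star (pos q t) = pos q t
star (neg q t) = neg q t
star (and A B) = and (star A) (star B)
star (or A B) = or (star A) (star B)
star (all A) = all (star A)
star (ex A) = ex (star A)

embX : ∀ {P} → Fm ⊤ false → Fm P true
embX (eq s t) = eq s t
embX (neq s t) = neq s t
embX (pos _ t) = mem 0 t
embX (neg _ t) = nmem 0 t
embX (and A B) = and (embX A) (embX B)
embX (or A B) = or (embX A) (embX B)
embX (all A) = all (embX A)
embX (ex A) = ex (embX A)

arith : ∀ {P} → Fm P true → Bool
arith (eq s t) = true
arith (neq s t) = true
arith (pos p t) = true
arith (neg p t) = true
arith (mem i t) = true
arith (nmem i t) = true
arith (and A B) = arith A ∧ arith B
arith (or A B) = arith A ∧ arith B
arith (all A) = arith A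
arith (ex A) = arith A
arith (all² A) = false
arith (ex² A) = false

noFreeSet : ∀ {P} → ℕ → Fm P true → Bool
noFreeSet k (eq s t) = true
noFreeSet k (neq s t) = true
noFreeSet k (pos p t) = false
noFreeSet k (neg p t) = false
noFreeSet k (mem i t) = i <ᵇ k
noFreeSet k (nmem i t) = i <ᵇ k
noFreeSet k (and A B) = noFreeSet k A ∧ noFreeSet k B
noFreeSet k (or A B) = noFreeSet k A ∧ noFreeSet k B
noFreeSet k (all A) = noFreeSet k A
noFreeSet k (ex A) = noFreeSet k A
noFreeSet k (all² A) = noFreeSet (suc k) A
noFreeSet k (ex² A) = noFreeSet (suc k) A

-- comprehension instance  ∃X ∀x (x ∈ X ↔ A(x))  (X not free in A)
compr : ∀ {P} → Fm P true → Fm P true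
compr A = ex² (all (and (or (nmem 0 v0) (shift² A)) (or (mem 0 v0) (~ shift² A))))

data ACA0Ax {P : Set} : Fm P true → Set where
  aca-eq : ∀ {A} → EqAx A → ACA0Ax A
  aca-pa : ∀ {A} → PABasic A → ACA0Ax A
  aca-ind : ACA0Ax (all² (or (nmem 0 tzero)
                     (or (ex (and (mem 0 v0) (nmem 0 (tsuc v0)))) (all (mem 0 v0)))))
  aca-ca : (A : Fm P true) → T (arith A) → ACA0Ax (compr A)

-- Π¹₁-CA₀⁻ : ACA_0 + Π¹₁-comprehension (Π¹₁ = ∀X θ, θ arithmetical),
-- without free set variables, number parameters allowed
data Pi11CA0mAx {P : Set} : Fm P true → Set where
  pi-aca : ∀ {A} → ACA0Ax A → Pi11CA0mAx A
  pi-ca : (θ : Fm P true) → T (arith θ ∧ noFreeSet 1 θ) → Pi11CA0mAx (compr (all² θ))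

Cl : Fm ⊤ false → Fm OpForm true
Cl φ = all (or (~ embX φ) (mem 0 v0))

LF : OpForm → Fm OpForm true
LF q = all (and (or (neg q v0) G) (or (pos q v0) (~ G)))
  where
  G : Fm OpForm true
  G = all² (or (~ Cl (proj₁ q)) (mem 0 v0))

data Occ (q : OpForm) : Fm OpForm false → Set where
  o-pos : ∀ {t} → Occ q (pos q t)
  o-neg : ∀ {t} → Occ q (neg q t)
  o-andl : ∀ {A B} → Occ q A → Occ q (and A B)
  o-andr : ∀ {A B} → Occ q B → Occ q (and A B)
  o-orl : ∀ {A B} → Occ q A → Occ q (or A B)
  o-orr : ∀ {A B} → Occ q B → Occ q (or A B)
  o-all : ∀ {A} → Occ q A → Occ q (all A)
  o-ex : ∀ {A} → Occ q A → Occ q (ex A)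

data TargetAx (ψ : Fm OpForm false) : Fm OpForm true → Set where
  t-base : ∀ {A} → Pi11CA0mAx A → TargetAx ψ A
  t-LF : (q : OpForm) → Occ q ψ → TargetAx ψ (LF q)

-- Read every I_φ as a set variable V_φ about which LF_φ(V_φ) is assumed: for φ occurring in ψ,
-- V_φ is Y_φ and the assumption is an axiom; for the other φ used in the derivation V_φ is a
-- fresh variable and LF_φ(V_φ) an open hypothesis. The translation commutes with every rule of
-- the sequent calculus, and the ID₁-axioms become provable: (F) since V_φ lies in every φ-closed
-- set and φ is monotone in X, (L) and induction by forming {x | θ⋆} with arithmetical
-- comprehension (θ⋆ is arithmetical because each I_φ became a set variable). Finally each open
-- hypothesis is discharged by a cut with ∃V LF_φ(V), an instance of Π¹₁-comprehension without
-- set parameters.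

module Submission where

open import Defs
open import Data.Bool using (Bool; true; false; T; _∧_)
open import Data.Bool.Properties using (T-∧; T-irrelevant)
open import Data.Empty using (⊥-elim)
open import Data.Fin using (toℕ)
open import Data.List using (List; []; _∷_; map; _++_)
open import Data.List.Properties using (map-∘; map-cong)
open import Data.List.Membership.Propositional using (_∈_)
open import Data.List.Membership.Propositional.Properties using (∈-map⁺; ∈-++⁺ˡ; ∈-++⁺ʳ)
open import Data.List.Relation.Binary.Subset.Propositional using (_⊆_)
open import Data.List.Relation.Binary.Subset.Propositional.Properties using (∷⁺ʳ; ∈-∷⁺ʳ; map⁺)
open import Data.List.Relation.Unary.Any using (here; there; index)
open import Data.Nat using (ℕ; zero; suc; _+_; _<ᵇ_; _≡ᵇ_)
open import Data.Nat.Properties using (+-suc; +-identityʳ; ≡ᵇ⇒≡; ≡⇒≡ᵇ)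
open import Data.Product using (_,_; proj₁; proj₂; _×_)
open import Data.Product.Properties using (≡-dec)
open import Data.Sum using (_⊎_; inj₁; inj₂; [_,_])
open import Data.Unit using (⊤; tt)
open import Function using (_∘_)
open import Function.Bundles using (Equivalence)
open import Relation.Binary.Definitions using (DecidableEquality)
open import Relation.Binary.PropositionalEquality using (_≡_; refl; sym; trans; cong; cong₂; subst; subst₂)
open import Relation.Nullary using (Dec; yes; no)
open import Relation.Nullary.Decidable using (map′; T?; _⊎-dec_)

T-∧ˡ : ∀ {a b} → T (a ∧ b) → T a
T-∧ˡ = proj₁ ∘ Equivalence.to T-∧

T-∧ʳ : ∀ {a b} → T (a ∧ b) → T b
T-∧ʳ = proj₂ ∘ Equivalence.to T-∧

T-∧⁺ : ∀ {a b} → T a → T b → T (a ∧ b)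
T-∧⁺ p q = Equivalence.from T-∧ (p , q)

_==ᵗ_ : Tm → Tm → Bool
tvar i ==ᵗ tvar j = i ≡ᵇ j
tzero ==ᵗ tzero = true
tsuc s ==ᵗ tsuc t = s ==ᵗ t
tadd s t ==ᵗ tadd s′ t′ = (s ==ᵗ s′) ∧ (t ==ᵗ t′)
tmul s t ==ᵗ tmul s′ t′ = (s ==ᵗ s′) ∧ (t ==ᵗ t′)
_ ==ᵗ _ = false

==ᵗ⇒≡ : ∀ s t → T (s ==ᵗ t) → s ≡ t
==ᵗ⇒≡ (tvar i) (tvar j) p = cong tvar (≡ᵇ⇒≡ i j p)
==ᵗ⇒≡ tzero tzero p = refl
==ᵗ⇒≡ (tsuc s) (tsuc t) p = cong tsuc (==ᵗ⇒≡ s t p)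
==ᵗ⇒≡ (tadd s t) (tadd s′ t′) p = cong₂ tadd (==ᵗ⇒≡ s s′ (T-∧ˡ p)) (==ᵗ⇒≡ t t′ (T-∧ʳ p))
==ᵗ⇒≡ (tmul s t) (tmul s′ t′) p = cong₂ tmul (==ᵗ⇒≡ s s′ (T-∧ˡ p)) (==ᵗ⇒≡ t t′ (T-∧ʳ p))

==ᵗ-refl : ∀ t → T (t ==ᵗ t)
==ᵗ-refl (tvar i) = ≡⇒≡ᵇ i i refl
==ᵗ-refl tzero = tt
==ᵗ-refl (tsuc t) = ==ᵗ-refl t
==ᵗ-refl (tadd s t) = T-∧⁺ (==ᵗ-refl s) (==ᵗ-refl t)
==ᵗ-refl (tmul s t) = T-∧⁺ (==ᵗ-refl s) (==ᵗ-refl t)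

_==ᶠ_ : Fm ⊤ false → Fm ⊤ false → Bool
eq s t ==ᶠ eq s′ t′ = (s ==ᵗ s′) ∧ (t ==ᵗ t′)
neq s t ==ᶠ neq s′ t′ = (s ==ᵗ s′) ∧ (t ==ᵗ t′)
pos _ t ==ᶠ pos _ t′ = t ==ᵗ t′
neg _ t ==ᶠ neg _ t′ = t ==ᵗ t′
and A B ==ᶠ and A′ B′ = (A ==ᶠ A′) ∧ (B ==ᶠ B′)
or A B ==ᶠ or A′ B′ = (A ==ᶠ A′) ∧ (B ==ᶠ B′)
all A ==ᶠ all A′ = A ==ᶠ A′
ex A ==ᶠ ex A′ = A ==ᶠ A′
_ ==ᶠ _ = false

==ᶠ⇒≡ : ∀ A B → T (A ==ᶠ B) → A ≡ B
==ᶠ⇒≡ (eq s t) (eq s′ t′) p = cong₂ eq (==ᵗ⇒≡ s s′ (T-∧ˡ p)) (==ᵗ⇒≡ t t′ (T-∧ʳ p))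
==ᶠ⇒≡ (neq s t) (neq s′ t′) p = cong₂ neq (==ᵗ⇒≡ s s′ (T-∧ˡ p)) (==ᵗ⇒≡ t t′ (T-∧ʳ p))
==ᶠ⇒≡ (pos tt t) (pos tt t′) p = cong (pos tt) (==ᵗ⇒≡ t t′ p)
==ᶠ⇒≡ (neg tt t) (neg tt t′) p = cong (neg tt) (==ᵗ⇒≡ t t′ p)
==ᶠ⇒≡ (and A B) (and A′ B′) p = cong₂ and (==ᶠ⇒≡ A A′ (T-∧ˡ p)) (==ᶠ⇒≡ B B′ (T-∧ʳ p))
==ᶠ⇒≡ (or A B) (or A′ B′) p = cong₂ or (==ᶠ⇒≡ A A′ (T-∧ˡ p)) (==ᶠ⇒≡ B B′ (T-∧ʳ p))
==ᶠ⇒≡ (all A) (all A′) p = cong all (==ᶠ⇒≡ A A′ p)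
==ᶠ⇒≡ (ex A) (ex A′) p = cong ex (==ᶠ⇒≡ A A′ p)

==ᶠ-refl : ∀ A → T (A ==ᶠ A)
==ᶠ-refl (eq s t) = T-∧⁺ (==ᵗ-refl s) (==ᵗ-refl t)
==ᶠ-refl (neq s t) = T-∧⁺ (==ᵗ-refl s) (==ᵗ-refl t)
==ᶠ-refl (pos _ t) = ==ᵗ-refl t
==ᶠ-refl (neg _ t) = ==ᵗ-refl t
==ᶠ-refl (and A B) = T-∧⁺ (==ᶠ-refl A) (==ᶠ-refl B)
==ᶠ-refl (or A B) = T-∧⁺ (==ᶠ-refl A) (==ᶠ-refl B)
==ᶠ-refl (all A) = ==ᶠ-refl A
==ᶠ-refl (ex A) = ==ᶠ-refl A

_≟ᶠ_ : DecidableEquality (Fm ⊤ false)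
A ≟ᶠ B = map′ (==ᶠ⇒≡ A B) (λ { refl → ==ᶠ-refl A }) (T? (A ==ᶠ B))

_≟ᵒ_ : DecidableEquality OpForm
_≟ᵒ_ = ≡-dec _≟ᶠ_ (λ p q → yes (T-irrelevant p q))

open import Data.List.Membership.DecPropositional _≟ᵒ_ using (_∈?_)

occ? : (q : OpForm) (ψ : Fm OpForm false) → Dec (Occ q ψ)
occ? q (eq s t) = no λ ()
occ? q (neq s t) = no λ ()
occ? q (pos q′ t) = map′ (λ { refl → o-pos }) (λ { o-pos → refl }) (q ≟ᵒ q′)
occ? q (neg q′ t) = map′ (λ { refl → o-neg }) (λ { o-neg → refl }) (q ≟ᵒ q′)
occ? q (and A B) = map′ [ o-andl , o-andr ] (λ { (o-andl o) → inj₁ o ; (o-andr o) → inj₂ o }) (occ? q A ⊎-dec occ? q B)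
occ? q (or A B) = map′ [ o-orl , o-orr ] (λ { (o-orl o) → inj₁ o ; (o-orr o) → inj₂ o }) (occ? q A ⊎-dec occ? q B)
occ? q (all A) = map′ o-all (λ { (o-all o) → o }) (occ? q A)
occ? q (ex A) = map′ o-ex (λ { (o-ex o) → o }) (occ? q A)

wkₛ : Sub
wkₛ i = tvar (suc i)

tsub-ext : ∀ {σ σ′} → (∀ i → σ i ≡ σ′ i) → ∀ t → tsub σ t ≡ tsub σ′ t
tsub-ext e (tvar i) = e i
tsub-ext e tzero = refl
tsub-ext e (tsuc t) = cong tsuc (tsub-ext e t)
tsub-ext e (tadd s t) = cong₂ tadd (tsub-ext e s) (tsub-ext e t)
tsub-ext e (tmul s t) = cong₂ tmul (tsub-ext e s) (tsub-ext e t)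

tsub-tsub : ∀ σ τ t → tsub σ (tsub τ t) ≡ tsub (tsub σ ∘ τ) t
tsub-tsub σ τ (tvar i) = refl
tsub-tsub σ τ tzero = refl
tsub-tsub σ τ (tsuc t) = cong tsuc (tsub-tsub σ τ t)
tsub-tsub σ τ (tadd s t) = cong₂ tadd (tsub-tsub σ τ s) (tsub-tsub σ τ t)
tsub-tsub σ τ (tmul s t) = cong₂ tmul (tsub-tsub σ τ s) (tsub-tsub σ τ t)

tsub-id : ∀ t → tsub tvar t ≡ t
tsub-id (tvar i) = refl
tsub-id tzero = refl
tsub-id (tsuc t) = cong tsuc (tsub-id t)
tsub-id (tadd s t) = cong₂ tadd (tsub-id s) (tsub-id t)
tsub-id (tmul s t) = cong₂ tmul (tsub-id s) (tsub-id t)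

liftS-ext : ∀ {σ σ′} → (∀ i → σ i ≡ σ′ i) → ∀ i → liftS σ i ≡ liftS σ′ i
liftS-ext e zero = refl
liftS-ext e (suc i) = cong (tsub wkₛ) (e i)

liftS-tsub : ∀ σ τ i → tsub (liftS σ) (liftS τ i) ≡ liftS (tsub σ ∘ τ) i
liftS-tsub σ τ zero = refl
liftS-tsub σ τ (suc i) = trans (tsub-tsub (liftS σ) wkₛ (τ i)) (sym (tsub-tsub wkₛ σ (τ i)))

liftS-id : ∀ i → liftS tvar i ≡ tvar i
liftS-id zero = refl
liftS-id (suc i) = refl

fsub-ext : ∀ {P b σ σ′} → (∀ i → σ i ≡ σ′ i) → (A : Fm P b) → fsub σ A ≡ fsub σ′ A
fsub-ext e (eq s t) = cong₂ eq (tsub-ext e s) (tsub-ext e t)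
fsub-ext e (neq s t) = cong₂ neq (tsub-ext e s) (tsub-ext e t)
fsub-ext e (pos p t) = cong (pos p) (tsub-ext e t)
fsub-ext e (neg p t) = cong (neg p) (tsub-ext e t)
fsub-ext e (mem i t) = cong (mem i) (tsub-ext e t)
fsub-ext e (nmem i t) = cong (nmem i) (tsub-ext e t)
fsub-ext e (and A B) = cong₂ and (fsub-ext e A) (fsub-ext e B)
fsub-ext e (or A B) = cong₂ or (fsub-ext e A) (fsub-ext e B)
fsub-ext e (all A) = cong all (fsub-ext (liftS-ext e) A)
fsub-ext e (ex A) = cong ex (fsub-ext (liftS-ext e) A)
fsub-ext e (all² A) = cong all² (fsub-ext e A)
fsub-ext e (ex² A) = cong ex² (fsub-ext e A)

fsub-fsub : ∀ {P b} σ τ (A : Fm P b) → fsub σ (fsub τ A) ≡ fsub (tsub σ ∘ τ) A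
fsub-fsub σ τ (eq s t) = cong₂ eq (tsub-tsub σ τ s) (tsub-tsub σ τ t)
fsub-fsub σ τ (neq s t) = cong₂ neq (tsub-tsub σ τ s) (tsub-tsub σ τ t)
fsub-fsub σ τ (pos p t) = cong (pos p) (tsub-tsub σ τ t)
fsub-fsub σ τ (neg p t) = cong (neg p) (tsub-tsub σ τ t)
fsub-fsub σ τ (mem i t) = cong (mem i) (tsub-tsub σ τ t)
fsub-fsub σ τ (nmem i t) = cong (nmem i) (tsub-tsub σ τ t)
fsub-fsub σ τ (and A B) = cong₂ and (fsub-fsub σ τ A) (fsub-fsub σ τ B)
fsub-fsub σ τ (or A B) = cong₂ or (fsub-fsub σ τ A) (fsub-fsub σ τ B)
fsub-fsub σ τ (all A) = cong all (trans (fsub-fsub (liftS σ) (liftS τ) A) (fsub-ext (liftS-tsub σ τ) A))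
fsub-fsub σ τ (ex A) = cong ex (trans (fsub-fsub (liftS σ) (liftS τ) A) (fsub-ext (liftS-tsub σ τ) A))
fsub-fsub σ τ (all² A) = cong all² (fsub-fsub σ τ A)
fsub-fsub σ τ (ex² A) = cong ex² (fsub-fsub σ τ A)

fsub-id : ∀ {P b} (A : Fm P b) → fsub tvar A ≡ A
fsub-id (eq s t) = cong₂ eq (tsub-id s) (tsub-id t)
fsub-id (neq s t) = cong₂ neq (tsub-id s) (tsub-id t)
fsub-id (pos p t) = cong (pos p) (tsub-id t)
fsub-id (neg p t) = cong (neg p) (tsub-id t)
fsub-id (mem i t) = cong (mem i) (tsub-id t)
fsub-id (nmem i t) = cong (nmem i) (tsub-id t)
fsub-id (and A B) = cong₂ and (fsub-id A) (fsub-id B)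
fsub-id (or A B) = cong₂ or (fsub-id A) (fsub-id B)
fsub-id (all A) = cong all (trans (fsub-ext liftS-id A) (fsub-id A))
fsub-id (ex A) = cong ex (trans (fsub-ext liftS-id A) (fsub-id A))
fsub-id (all² A) = cong all² (fsub-id A)
fsub-id (ex² A) = cong ex² (fsub-id A)

~-involutive : ∀ {P b} (A : Fm P b) → ~ (~ A) ≡ A
~-involutive (eq s t) = refl
~-involutive (neq s t) = refl
~-involutive (pos p t) = refl
~-involutive (neg p t) = refl
~-involutive (mem i t) = refl
~-involutive (nmem i t) = refl
~-involutive (and A B) = cong₂ and (~-involutive A) (~-involutive B)
~-involutive (or A B) = cong₂ or (~-involutive A) (~-involutive B)
~-involutive (all A) = cong all (~-involutive A)
~-involutive (ex A) = cong ex (~-involutive A)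
~-involutive (all² A) = cong all² (~-involutive A)
~-involutive (ex² A) = cong ex² (~-involutive A)

fsub-~ : ∀ {P b} σ (A : Fm P b) → fsub σ (~ A) ≡ ~ fsub σ A
fsub-~ σ (eq s t) = refl
fsub-~ σ (neq s t) = refl
fsub-~ σ (pos p t) = refl
fsub-~ σ (neg p t) = refl
fsub-~ σ (mem i t) = refl
fsub-~ σ (nmem i t) = refl
fsub-~ σ (and A B) = cong₂ or (fsub-~ σ A) (fsub-~ σ B)
fsub-~ σ (or A B) = cong₂ and (fsub-~ σ A) (fsub-~ σ B)
fsub-~ σ (all A) = cong ex (fsub-~ (liftS σ) A)
fsub-~ σ (ex A) = cong all (fsub-~ (liftS σ) A)
fsub-~ σ (all² A) = cong ex² (fsub-~ σ A)
fsub-~ σ (ex² A) = cong all² (fsub-~ σ A)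

sub0-liftS : ∀ {P b} σ (A : Fm P b) t → sub0 (fsub (liftS σ) A) t ≡ fsub (t ∷ₛ σ) A
sub0-liftS σ A t = trans (fsub-fsub (t ∷ₛ tvar) (liftS σ) A) (fsub-ext pointwise A)
  where
  pointwise : ∀ i → tsub (t ∷ₛ tvar) (liftS σ i) ≡ (t ∷ₛ σ) i
  pointwise zero = refl
  pointwise (suc i) = trans (tsub-tsub (t ∷ₛ tvar) wkₛ (σ i)) (tsub-id (σ i))

fsub-v0∷wkₛ : ∀ {P b} (A : Fm P b) → fsub (tvar 0 ∷ₛ wkₛ) A ≡ A
fsub-v0∷wkₛ A = trans (fsub-ext pointwise A) (fsub-id A)
  where
  pointwise : ∀ i → (tvar 0 ∷ₛ wkₛ) i ≡ tvar i
  pointwise zero = refl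
  pointwise (suc i) = refl

sub0-liftS-wkₛ : ∀ {P b} (A : Fm P b) → sub0 (fsub (liftS wkₛ) A) (tvar 0) ≡ A
sub0-liftS-wkₛ A = trans (sub0-liftS wkₛ A (tvar 0)) (fsub-v0∷wkₛ A)

wkˢ : ∀ {P} → SSub P
wkˢ i = sv (suc i)

ssubSV : ∀ {P} → SSub P → SV P → SV P
ssubSV τ (sv j) = τ j
ssubSV τ (sc p) = sc p

~-memSV : ∀ {P} (V : SV P) t → ~ memSV V t ≡ nmemSV V t
~-memSV (sv j) t = refl
~-memSV (sc p) t = refl

~-nmemSV : ∀ {P} (V : SV P) t → ~ nmemSV V t ≡ memSV V t
~-nmemSV (sv j) t = refl
~-nmemSV (sc p) t = refl

fsub-memSV : ∀ {P} σ (V : SV P) t → fsub σ (memSV V t) ≡ memSV V (tsub σ t)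
fsub-memSV σ (sv j) t = refl
fsub-memSV σ (sc p) t = refl

fsub-nmemSV : ∀ {P} σ (V : SV P) t → fsub σ (nmemSV V t) ≡ nmemSV V (tsub σ t)
fsub-nmemSV σ (sv j) t = refl
fsub-nmemSV σ (sc p) t = refl

ssub-memSV : ∀ {P} τ (V : SV P) t → ssub τ (memSV V t) ≡ memSV (ssubSV τ V) t
ssub-memSV τ (sv j) t = refl
ssub-memSV τ (sc p) t = refl

ssub-nmemSV : ∀ {P} τ (V : SV P) t → ssub τ (nmemSV V t) ≡ nmemSV (ssubSV τ V) t
ssub-nmemSV τ (sv j) t = refl
ssub-nmemSV τ (sc p) t = refl

ssub-~ : ∀ {P} τ (A : Fm P true) → ssub τ (~ A) ≡ ~ ssub τ A
ssub-~ τ (eq s t) = refl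
ssub-~ τ (neq s t) = refl
ssub-~ τ (pos p t) = refl
ssub-~ τ (neg p t) = refl
ssub-~ τ (mem i t) = sym (~-memSV (τ i) t)
ssub-~ τ (nmem i t) = sym (~-nmemSV (τ i) t)
ssub-~ τ (and A B) = cong₂ or (ssub-~ τ A) (ssub-~ τ B)
ssub-~ τ (or A B) = cong₂ and (ssub-~ τ A) (ssub-~ τ B)
ssub-~ τ (all A) = cong ex (ssub-~ τ A)
ssub-~ τ (ex A) = cong all (ssub-~ τ A)
ssub-~ τ (all² A) = cong ex² (ssub-~ (liftSS τ) A)
ssub-~ τ (ex² A) = cong all² (ssub-~ (liftSS τ) A)

FixesBelow : ℕ → Sub → Set
FixesBelow k σ = ∀ i → T (i <ᵇ k) → σ i ≡ tvar i

liftS-fixesBelow : ∀ {k σ} → FixesBelow k σ → FixesBelow (suc k) (liftS σ)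
liftS-fixesBelow h zero _ = refl
liftS-fixesBelow h (suc i) p = cong (tsub wkₛ) (h i p)

tsub-fixesBelow : ∀ {k σ} t → T (tmBelow k t) → FixesBelow k σ → tsub σ t ≡ t
tsub-fixesBelow (tvar i) p h = h i p
tsub-fixesBelow tzero p h = refl
tsub-fixesBelow (tsuc t) p h = cong tsuc (tsub-fixesBelow t p h)
tsub-fixesBelow (tadd s t) p h = cong₂ tadd (tsub-fixesBelow s (T-∧ˡ p) h) (tsub-fixesBelow t (T-∧ʳ p) h)
tsub-fixesBelow (tmul s t) p h = cong₂ tmul (tsub-fixesBelow s (T-∧ˡ p) h) (tsub-fixesBelow t (T-∧ʳ p) h)

fsub-embX-fixesBelow : ∀ {P k σ} (φ : Fm ⊤ false) → T (fmBelow k φ) → FixesBelow k σ → fsub σ (embX {P} φ) ≡ embX φ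
fsub-embX-fixesBelow (eq s t) p h = cong₂ eq (tsub-fixesBelow s (T-∧ˡ p) h) (tsub-fixesBelow t (T-∧ʳ p) h)
fsub-embX-fixesBelow (neq s t) p h = cong₂ neq (tsub-fixesBelow s (T-∧ˡ p) h) (tsub-fixesBelow t (T-∧ʳ p) h)
fsub-embX-fixesBelow (pos _ t) p h = cong (mem 0) (tsub-fixesBelow t p h)
fsub-embX-fixesBelow (neg _ t) p h = cong (nmem 0) (tsub-fixesBelow t p h)
fsub-embX-fixesBelow (and A B) p h = cong₂ and (fsub-embX-fixesBelow A (T-∧ˡ p) h) (fsub-embX-fixesBelow B (T-∧ʳ p) h)
fsub-embX-fixesBelow (or A B) p h = cong₂ or (fsub-embX-fixesBelow A (T-∧ˡ p) h) (fsub-embX-fixesBelow B (T-∧ʳ p) h)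
fsub-embX-fixesBelow (all A) p h = cong all (fsub-embX-fixesBelow A p (liftS-fixesBelow h))
fsub-embX-fixesBelow (ex A) p h = cong ex (fsub-embX-fixesBelow A p (liftS-fixesBelow h))

ssub-embX : ∀ {P} (φ : Fm ⊤ false) (τ : SSub P) → τ 0 ≡ sv 0 → ssub τ (embX φ) ≡ embX φ
ssub-embX (eq s t) τ e = refl
ssub-embX (neq s t) τ e = refl
ssub-embX (pos _ t) τ e = cong (λ V → memSV V t) e
ssub-embX (neg _ t) τ e = cong (λ V → nmemSV V t) e
ssub-embX (and A B) τ e = cong₂ and (ssub-embX A τ e) (ssub-embX B τ e)
ssub-embX (or A B) τ e = cong₂ or (ssub-embX A τ e) (ssub-embX B τ e)
ssub-embX (all A) τ e = cong all (ssub-embX A τ e)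
ssub-embX (ex A) τ e = cong ex (ssub-embX A τ e)

arith-embX : ∀ {P} (φ : Fm ⊤ false) → T (arith {P} (embX φ))
arith-embX (eq s t) = tt
arith-embX (neq s t) = tt
arith-embX (pos _ t) = tt
arith-embX (neg _ t) = tt
arith-embX (and A B) = T-∧⁺ (arith-embX A) (arith-embX B)
arith-embX (or A B) = T-∧⁺ (arith-embX A) (arith-embX B)
arith-embX (all A) = arith-embX A
arith-embX (ex A) = arith-embX A

noFreeSet-embX : ∀ {P} (φ : Fm ⊤ false) → T (noFreeSet {P} 1 (embX φ))
noFreeSet-embX (eq s t) = tt
noFreeSet-embX (neq s t) = tt
noFreeSet-embX (pos _ t) = tt
noFreeSet-embX (neg _ t) = tt
noFreeSet-embX (and A B) = T-∧⁺ (noFreeSet-embX A) (noFreeSet-embX B)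
noFreeSet-embX (or A B) = T-∧⁺ (noFreeSet-embX A) (noFreeSet-embX B)
noFreeSet-embX (all A) = noFreeSet-embX A
noFreeSet-embX (ex A) = noFreeSet-embX A

arith-~ : ∀ {P} (A : Fm P true) → arith (~ A) ≡ arith A
arith-~ (eq s t) = refl
arith-~ (neq s t) = refl
arith-~ (pos p t) = refl
arith-~ (neg p t) = refl
arith-~ (mem i t) = refl
arith-~ (nmem i t) = refl
arith-~ (and A B) = cong₂ _∧_ (arith-~ A) (arith-~ B)
arith-~ (or A B) = cong₂ _∧_ (arith-~ A) (arith-~ B)
arith-~ (all A) = arith-~ A
arith-~ (ex A) = arith-~ A
arith-~ (all² A) = refl
arith-~ (ex² A) = refl

noFreeSet-~ : ∀ {P} k (A : Fm P true) → noFreeSet k (~ A) ≡ noFreeSet k A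
noFreeSet-~ k (eq s t) = refl
noFreeSet-~ k (neq s t) = refl
noFreeSet-~ k (pos p t) = refl
noFreeSet-~ k (neg p t) = refl
noFreeSet-~ k (mem i t) = refl
noFreeSet-~ k (nmem i t) = refl
noFreeSet-~ k (and A B) = cong₂ _∧_ (noFreeSet-~ k A) (noFreeSet-~ k B)
noFreeSet-~ k (or A B) = cong₂ _∧_ (noFreeSet-~ k A) (noFreeSet-~ k B)
noFreeSet-~ k (all A) = noFreeSet-~ k A
noFreeSet-~ k (ex A) = noFreeSet-~ k A
noFreeSet-~ k (all² A) = noFreeSet-~ (suc k) A
noFreeSet-~ k (ex² A) = noFreeSet-~ (suc k) A

arith-~Cl : ∀ φ → T (arith (~ Cl φ))
arith-~Cl φ = subst T (sym (arith-~ (Cl φ)))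
  (T-∧⁺ (subst T (sym (arith-~ (embX φ))) (arith-embX φ)) tt)

noFreeSet-~Cl : ∀ φ → T (noFreeSet 1 (~ Cl φ))
noFreeSet-~Cl φ = subst T (sym (noFreeSet-~ 1 (Cl φ)))
  (T-∧⁺ (subst T (sym (noFreeSet-~ 1 (embX φ))) (noFreeSet-embX φ)) tt)

positive-op : (q : OpForm) → T (positive (proj₁ q))
positive-op (φ , p) = T-∧ˡ {positive φ} p

fmBelow-op : (q : OpForm) → T (fmBelow 1 (proj₁ q))
fmBelow-op (φ , p) = T-∧ʳ {positive φ} p

fsub-Cl : ∀ (q : OpForm) σ → fsub σ (Cl (proj₁ q)) ≡ Cl (proj₁ q)
fsub-Cl q σ = cong (λ A → all (or A (mem 0 v0)))
  (trans (fsub-~ (liftS σ) (embX (proj₁ q))) (cong ~_ (fsub-embX-fixesBelow (proj₁ q) (fmBelow-op q) fixes0)))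
  where
  fixes0 : FixesBelow 1 (liftS σ)
  fixes0 zero _ = refl

ssub-Cl : ∀ (q : OpForm) τ → τ 0 ≡ sv 0 → ssub τ (Cl (proj₁ q)) ≡ Cl (proj₁ q)
ssub-Cl q τ e = cong₂ (λ A B → all (or A B))
  (trans (ssub-~ τ (embX (proj₁ q))) (cong ~_ (ssub-embX (proj₁ q) τ e)))
  (cong (λ V → memSV V v0) e)

inAllClosed : OpForm → Tm → Fm OpForm true
inAllClosed q t = all² (or (~ Cl (proj₁ q)) (mem 0 t))

fsub-inAllClosed : ∀ q σ t → fsub σ (inAllClosed q t) ≡ inAllClosed q (tsub σ t)
fsub-inAllClosed q σ t = cong (λ A → all² (or A (mem 0 (tsub σ t))))
  (trans (fsub-~ σ (Cl (proj₁ q))) (cong ~_ (fsub-Cl q σ)))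

ssub-inAllClosed : ∀ q τ t → ssub τ (inAllClosed q t) ≡ inAllClosed q t
ssub-inAllClosed q τ t = cong (λ A → all² (or A (mem 0 t)))
  (trans (ssub-~ (liftSS τ) (Cl (proj₁ q))) (cong ~_ (ssub-Cl q (liftSS τ) refl)))

LF-body : OpForm → SV OpForm → Tm → Fm OpForm true
LF-body q V t = and (or (nmemSV V t) (inAllClosed q t)) (or (memSV V t) (~ inAllClosed q t))

-- LF_φ with Y_φ replaced by an arbitrary set variable; LF[ q ] (sc q) is LF q by definition.
LF[_] : OpForm → SV OpForm → Fm OpForm true
LF[ q ] V = all (LF-body q V v0)

fsub-LF-body : ∀ q V σ t → fsub σ (LF-body q V t) ≡ LF-body q V (tsub σ t)
fsub-LF-body q V σ t = cong₂ and
  (cong₂ or (fsub-nmemSV σ V t) (fsub-inAllClosed q σ t))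
  (cong₂ or (fsub-memSV σ V t) (trans (fsub-~ σ (inAllClosed q t)) (cong ~_ (fsub-inAllClosed q σ t))))

ssub-LF-body : ∀ q V τ t → ssub τ (LF-body q V t) ≡ LF-body q (ssubSV τ V) t
ssub-LF-body q V τ t = cong₂ and
  (cong₂ or (ssub-nmemSV τ V t) (ssub-inAllClosed q τ t))
  (cong₂ or (ssub-memSV τ V t) (trans (ssub-~ τ (inAllClosed q t)) (cong ~_ (ssub-inAllClosed q τ t))))

fsub-LF : ∀ q V σ → fsub σ (LF[ q ] V) ≡ LF[ q ] V
fsub-LF q V σ = cong all (fsub-LF-body q V (liftS σ) v0)

ssub-LF : ∀ q V τ → ssub τ (LF[ q ] V) ≡ LF[ q ] (ssubSV τ V)
ssub-LF q V τ = cong all (ssub-LF-body q V τ v0)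

~LF-instance : ∀ q V t →
  sub0 (~ LF-body q V v0) t ≡ or (and (memSV V t) (~ inAllClosed q t)) (and (~ memSV V t) (inAllClosed q t))
~LF-instance q V t = trans (fsub-~ (t ∷ₛ tvar) (LF-body q V v0)) (trans (cong ~_ (fsub-LF-body q V (t ∷ₛ tvar) v0))
  (cong₂ (λ A B → or (and A (~ inAllClosed q t)) (and (~ memSV V t) B)) (~-nmemSV V t) (~-involutive (inAllClosed q t))))

Assignment : Set
Assignment = OpForm → SV OpForm

star[_]_ : Assignment → Fm OpForm false → Fm OpForm true
star[ ρ ] eq s t = eq s t
star[ ρ ] neq s t = neq s t
star[ ρ ] pos q t = memSV (ρ q) t
star[ ρ ] neg q t = nmemSV (ρ q) t
star[ ρ ] and A B = and (star[ ρ ] A) (star[ ρ ] B)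
star[ ρ ] or A B = or (star[ ρ ] A) (star[ ρ ] B)
star[ ρ ] all A = all (star[ ρ ] A)
star[ ρ ] ex A = ex (star[ ρ ] A)

star-~ : ∀ ρ A → star[ ρ ] (~ A) ≡ ~ star[ ρ ] A
star-~ ρ (eq s t) = refl
star-~ ρ (neq s t) = refl
star-~ ρ (pos q t) = sym (~-memSV (ρ q) t)
star-~ ρ (neg q t) = sym (~-nmemSV (ρ q) t)
star-~ ρ (and A B) = cong₂ or (star-~ ρ A) (star-~ ρ B)
star-~ ρ (or A B) = cong₂ and (star-~ ρ A) (star-~ ρ B)
star-~ ρ (all A) = cong ex (star-~ ρ A)
star-~ ρ (ex A) = cong all (star-~ ρ A)

star-fsub : ∀ ρ σ A → star[ ρ ] (fsub σ A) ≡ fsub σ (star[ ρ ] A)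
star-fsub ρ σ (eq s t) = refl
star-fsub ρ σ (neq s t) = refl
star-fsub ρ σ (pos q t) = sym (fsub-memSV σ (ρ q) t)
star-fsub ρ σ (neg q t) = sym (fsub-nmemSV σ (ρ q) t)
star-fsub ρ σ (and A B) = cong₂ and (star-fsub ρ σ A) (star-fsub ρ σ B)
star-fsub ρ σ (or A B) = cong₂ or (star-fsub ρ σ A) (star-fsub ρ σ B)
star-fsub ρ σ (all A) = cong all (star-fsub ρ (liftS σ) A)
star-fsub ρ σ (ex A) = cong ex (star-fsub ρ (liftS σ) A)

ssub-star : ∀ ρ τ A → ssub τ (star[ ρ ] A) ≡ star[ ssubSV τ ∘ ρ ] A
ssub-star ρ τ (eq s t) = refl
ssub-star ρ τ (neq s t) = refl
ssub-star ρ τ (pos q t) = ssub-memSV τ (ρ q) t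
ssub-star ρ τ (neg q t) = ssub-nmemSV τ (ρ q) t
ssub-star ρ τ (and A B) = cong₂ and (ssub-star ρ τ A) (ssub-star ρ τ B)
ssub-star ρ τ (or A B) = cong₂ or (ssub-star ρ τ A) (ssub-star ρ τ B)
ssub-star ρ τ (all A) = cong all (ssub-star ρ τ A)
ssub-star ρ τ (ex A) = cong ex (ssub-star ρ τ A)

star-occurring : ∀ ρ A → (∀ q → Occ q A → ρ q ≡ sc q) → star[ ρ ] A ≡ star A
star-occurring ρ (eq s t) h = refl
star-occurring ρ (neq s t) h = refl
star-occurring ρ (pos q t) h = cong (λ V → memSV V t) (h q o-pos)
star-occurring ρ (neg q t) h = cong (λ V → nmemSV V t) (h q o-neg)
star-occurring ρ (and A B) h =
  cong₂ and (star-occurring ρ A (λ q → h q ∘ o-andl)) (star-occurring ρ B (λ q → h q ∘ o-andr))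
star-occurring ρ (or A B) h =
  cong₂ or (star-occurring ρ A (λ q → h q ∘ o-orl)) (star-occurring ρ B (λ q → h q ∘ o-orr))
star-occurring ρ (all A) h = cong all (star-occurring ρ A (λ q → h q ∘ o-all))
star-occurring ρ (ex A) h = cong ex (star-occurring ρ A (λ q → h q ∘ o-ex))

shift²-star : ∀ ψ → shift² (star ψ) ≡ star ψ
shift²-star ψ = trans (cong shift² (sym star[sc])) (trans (ssub-star sc wkˢ ψ) star[sc])
  where
  star[sc] : star[ sc ] ψ ≡ star ψ
  star[sc] = star-occurring sc ψ (λ _ _ → refl)

arith-memSV : ∀ {P} (V : SV P) t → T (arith (memSV V t))
arith-memSV (sv j) t = tt
arith-memSV (sc p) t = tt

arith-nmemSV : ∀ {P} (V : SV P) t → T (arith (nmemSV V t))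
arith-nmemSV (sv j) t = tt
arith-nmemSV (sc p) t = tt

arith-star : ∀ ρ A → T (arith (star[ ρ ] A))
arith-star ρ (eq s t) = tt
arith-star ρ (neq s t) = tt
arith-star ρ (pos q t) = arith-memSV (ρ q) t
arith-star ρ (neg q t) = arith-nmemSV (ρ q) t
arith-star ρ (and A B) = T-∧⁺ (arith-star ρ A) (arith-star ρ B)
arith-star ρ (or A B) = T-∧⁺ (arith-star ρ A) (arith-star ρ B)
arith-star ρ (all A) = arith-star ρ A
arith-star ρ (ex A) = arith-star ρ A

F-axiom : OpForm → Fm OpForm false
F-axiom q = all (or (~ toI q (proj₁ q)) (pos q v0))

L-axiom : OpForm → Fm OpForm false → Fm OpForm false
L-axiom q ψ = or (~ all (or (~ plug 0 (proj₁ q) ψ) ψ)) (all (or (neg q v0) ψ))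

induction-instance : ∀ {P b} → Fm P b → Fm P b
induction-instance A = or (~ sub0 A tzero) (or (ex (and A (~ fsub (tsuc v0 ∷ₛ wkₛ) A))) (all A))

star-induction : ∀ ρ A → star[ ρ ] induction-instance A ≡ induction-instance (star[ ρ ] A)
star-induction ρ A = cong₂ or (trans (star-~ ρ (sub0 A tzero)) (cong ~_ (star-fsub ρ _ A)))
  (cong (λ B → or (ex (and (star[ ρ ] A) B)) (all (star[ ρ ] A)))
    (trans (star-~ ρ (fsub (tsuc v0 ∷ₛ wkₛ) A)) (cong ~_ (star-fsub ρ _ A))))

star-PABasic : ∀ ρ {A} → PABasic A → PABasic (star[ ρ ] A)
star-PABasic ρ pa1 = pa1
star-PABasic ρ pa2 = pa2
star-PABasic ρ pa3 = pa3
star-PABasic ρ pa4 = pa4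
star-PABasic ρ pa5 = pa5
star-PABasic ρ pa6 = pa6

star-EqAx : ∀ ρ {A} → EqAx A → EqAx (star[ ρ ] A)
star-EqAx ρ eq-refl = eq-refl
star-EqAx ρ (eq-subst A) = subst EqAx (cong (λ B → all (all (or (neq v1 v0) B)))
  (sym (cong₂ or (trans (star-~ ρ (fsub σ₁ A)) (cong ~_ (star-fsub ρ σ₁ A))) (star-fsub ρ σ₀ A))))
  (eq-subst (star[ ρ ] A))
  where
  σ₁ σ₀ : Sub
  σ₁ = v1 ∷ₛ (λ i → tvar (suc (suc i)))
  σ₀ = v0 ∷ₛ (λ i → tvar (suc (suc i)))

star-shift : ∀ ρ Γ → map (star[ ρ ]_) (map shift Γ) ≡ map shift (map (star[ ρ ]_) Γ)
star-shift ρ Γ = trans (sym (map-∘ Γ)) (trans (map-cong (star-fsub ρ wkₛ) Γ) (map-∘ Γ))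

-- X t replaced by L k t, where k counts the number quantifiers above the occurrence.

fill : ∀ {P} → (ℕ → Tm → Fm P true) → ℕ → Fm ⊤ false → Fm P true
fill L k (eq s t) = eq s t
fill L k (neq s t) = neq s t
fill L k (pos _ t) = L k t
fill L k (neg _ t) = ~ L k t
fill L k (and A B) = and (fill L k A) (fill L k B)
fill L k (or A B) = or (fill L k A) (fill L k B)
fill L k (all A) = all (fill L (suc k) A)
fill L k (ex A) = ex (fill L (suc k) A)

embX-fill : ∀ {P} k (φ : Fm ⊤ false) → embX {P} φ ≡ fill (λ _ → mem 0) k φ
embX-fill k (eq s t) = refl
embX-fill k (neq s t) = refl
embX-fill k (pos _ t) = refl
embX-fill k (neg _ t) = refl
embX-fill k (and A B) = cong₂ and (embX-fill k A) (embX-fill k B)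
embX-fill k (or A B) = cong₂ or (embX-fill k A) (embX-fill k B)
embX-fill k (all A) = cong all (embX-fill (suc k) A)
embX-fill k (ex A) = cong ex (embX-fill (suc k) A)

star-toI : ∀ ρ q k (φ : Fm ⊤ false) → star[ ρ ] (toI q φ) ≡ fill (λ _ → memSV (ρ q)) k φ
star-toI ρ q k (eq s t) = refl
star-toI ρ q k (neq s t) = refl
star-toI ρ q k (pos _ t) = refl
star-toI ρ q k (neg _ t) = sym (~-memSV (ρ q) t)
star-toI ρ q k (and A B) = cong₂ and (star-toI ρ q k A) (star-toI ρ q k B)
star-toI ρ q k (or A B) = cong₂ or (star-toI ρ q k A) (star-toI ρ q k B)
star-toI ρ q k (all A) = cong all (star-toI ρ q (suc k) A)
star-toI ρ q k (ex A) = cong ex (star-toI ρ q (suc k) A)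

-- The substitution that plug k applies to ψ.
paramsUnder : ℕ → Sub
paramsUnder k i = tvar (suc (i + k))

ψ-at : Fm OpForm true → ℕ → Tm → Fm OpForm true
ψ-at B k t = fsub (t ∷ₛ paramsUnder k) B

star-plug : ∀ ρ k (φ : Fm ⊤ false) ψ →
  star[ ρ ] (plug k φ ψ) ≡ fill (ψ-at (star[ ρ ] ψ)) k φ
star-plug ρ k (eq s t) ψ = refl
star-plug ρ k (neq s t) ψ = refl
star-plug ρ k (pos _ t) ψ = star-fsub ρ (t ∷ₛ paramsUnder k) ψ
star-plug ρ k (neg _ t) ψ = trans (star-~ ρ (fsub (t ∷ₛ paramsUnder k) ψ)) (cong ~_ (star-fsub ρ (t ∷ₛ paramsUnder k) ψ))
star-plug ρ k (and A B) ψ = cong₂ and (star-plug ρ k A ψ) (star-plug ρ k B ψ)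
star-plug ρ k (or A B) ψ = cong₂ or (star-plug ρ k A ψ) (star-plug ρ k B ψ)
star-plug ρ k (all A) ψ = cong all (star-plug ρ (suc k) A ψ)
star-plug ρ k (ex A) ψ = cong ex (star-plug ρ (suc k) A ψ)

pattern #0 = here refl
pattern #1 = there #0
pattern #2 = there #1
pattern #3 = there #2
pattern #4 = there #3
pattern #5 = there #4
pattern #6 = there #5

pattern ↑² p = there (there p)
pattern ↑³ p = there (↑² p)
pattern ↑⁴ p = there (↑³ p)
pattern ↑⁵ p = there (↑⁴ p)
pattern ↑⁶ p = there (↑⁵ p)
pattern ↑⁷ p = there (↑⁶ p)

weaken : ∀ {P b Th Γ Δ} → Der {P} b Th Γ → Γ ⊆ Δ → Der b Th Δ
weaken (axm p q) s = axm (s p) (s q)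
weaken (thy t p) s = thy t (s p)
weaken (andR p d e) s = andR (s p) (weaken d (∷⁺ʳ _ s)) (weaken e (∷⁺ʳ _ s))
weaken (orR p d) s = orR (s p) (weaken d (∷⁺ʳ _ (∷⁺ʳ _ s)))
weaken (allR p d) s = allR (s p) (weaken d (∷⁺ʳ _ (map⁺ shift s)))
weaken (exR p t d) s = exR (s p) t (weaken d (∷⁺ʳ _ s))
weaken (all²R p d) s = all²R (s p) (weaken d (∷⁺ʳ _ (map⁺ shift² s)))
weaken (ex²R p V d) s = ex²R (s p) V (weaken d (∷⁺ʳ _ s))
weaken (cut A d e) s = cut A (weaken d (∷⁺ʳ _ s)) (weaken e (∷⁺ʳ _ s))

∈-resp-≡ : ∀ {A : Set} {x y : A} {xs} → x ≡ y → x ∈ xs → y ∈ xs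
∈-resp-≡ refl m = m

cast-head : ∀ {P b Th Γ} {A B : Fm P b} → A ≡ B → Der b Th (B ∷ Γ) → Der b Th (A ∷ Γ)
cast-head refl d = d

contract : ∀ {P b Th Γ} {A : Fm P b} → A ∈ Γ → Der b Th (A ∷ Γ) → Der b Th Γ
contract m d = weaken d (∈-∷⁺ʳ m (λ p → p))

contract₀ : ∀ {P b Th Γ} {A B : Fm P b} → A ∈ Γ → Der b Th (A ∷ B ∷ Γ) → Der b Th (B ∷ Γ)
contract₀ m d = weaken d λ { #0 → there m ; #1 → #0 ; (↑² p) → there p }

contract₁ : ∀ {P b Th Γ} {A B : Fm P b} → B ∈ Γ → Der b Th (A ∷ B ∷ Γ) → Der b Th (A ∷ Γ)
contract₁ m d = weaken d λ { #0 → #0 ; #1 → there m ; (↑² p) → there p }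

exR-fresh : ∀ {P b Th Γ} {A : Fm P b} → ex (fsub (liftS wkₛ) A) ∈ Γ → Der b Th (A ∷ Γ) → Der b Th Γ
exR-fresh {A = A} m d = exR m (tvar 0) (cast-head (sub0-liftS-wkₛ A) d)

chain : ∀ {P b Th Γ} {A B C : Fm P b} → Der b Th (~ A ∷ B ∷ Γ) → Der b Th (~ B ∷ C ∷ Γ) → Der b Th (~ A ∷ C ∷ Γ)
chain {B = B} d e = cut B (weaken d λ { #0 → #1 ; #1 → #0 ; (↑² p) → ↑³ p })
                          (weaken e λ { #0 → #0 ; #1 → #2 ; (↑² p) → ↑³ p })

and-mono : ∀ {P b Th Δ} {A A′ B B′ : Fm P b} →
  Der b Th (~ A ∷ A′ ∷ Δ) → Der b Th (~ B ∷ B′ ∷ Δ) → Der b Th (~ and A B ∷ and A′ B′ ∷ Δ)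
and-mono dA dB = orR #0 (andR #3 (weaken dA λ { #0 → #1 ; #1 → #0 ; (↑² p) → ↑⁵ p })
                                 (weaken dB λ { #0 → #2 ; #1 → #0 ; (↑² p) → ↑⁵ p }))

or-mono : ∀ {P b Th Δ} {A A′ B B′ : Fm P b} →
  Der b Th (~ A ∷ A′ ∷ Δ) → Der b Th (~ B ∷ B′ ∷ Δ) → Der b Th (~ or A B ∷ or A′ B′ ∷ Δ)
or-mono dA dB = andR #0 (orR #2 (weaken dA λ { #0 → #2 ; #1 → #0 ; (↑² p) → ↑⁵ p }))
                        (orR #2 (weaken dB λ { #0 → #2 ; #1 → #1 ; (↑² p) → ↑⁵ p }))

all-mono : ∀ {P b Th Δ} {A A′ : Fm P b} →
  Der b Th (~ A ∷ A′ ∷ map shift Δ) → Der b Th (~ all A ∷ all A′ ∷ Δ)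
all-mono d = allR #1 (exR-fresh #1 (weaken d λ { #0 → #0 ; #1 → #1 ; (↑² p) → ↑⁴ p }))

ex-mono : ∀ {P b Th Δ} {A A′ : Fm P b} →
  Der b Th (~ A ∷ A′ ∷ map shift Δ) → Der b Th (~ ex A ∷ ex A′ ∷ Δ)
ex-mono d = allR #0 (exR-fresh #2 (weaken d λ { #0 → #1 ; #1 → #0 ; (↑² p) → ↑⁴ p }))

-- An invariant Inv of the side formulas, preserved when passing under a number quantifier,
-- lets the hypothesis L ⊆ R be used at every depth.
fill-monotone : ∀ {P Th} (L R : ℕ → Tm → Fm P true) (Inv : ℕ → List (Fm P true) → Set) →
  (∀ {k Δ} → Inv k Δ → Inv (suc k) (map shift Δ)) →
  (∀ {k Δ} t → Inv k Δ → Der true Th (~ L k t ∷ R k t ∷ Δ)) →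
  (φ : Fm ⊤ false) → T (positive φ) → ∀ {k Δ} → Inv k Δ → Der true Th (~ fill L k φ ∷ fill R k φ ∷ Δ)
fill-monotone L R Inv shift-inv L⊆R = go
  where
  go : (φ : Fm ⊤ false) → T (positive φ) → ∀ {k Δ} → Inv k Δ → Der _ _ (~ fill L k φ ∷ fill R k φ ∷ Δ)
  go (eq s t) _ _ = axm #1 #0
  go (neq s t) _ _ = axm #1 #0
  go (pos _ t) _ inv = L⊆R t inv
  go (and A B) p inv = and-mono (go A (T-∧ˡ p) inv) (go B (T-∧ʳ p) inv)
  go (or A B) p inv = or-mono (go A (T-∧ˡ p) inv) (go B (T-∧ʳ p) inv)
  go (all A) p inv = all-mono (go A p (shift-inv inv))
  go (ex A) p inv = ex-mono (go A p (shift-inv inv))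

-- The negated matrix of the comprehension instance for B.
disagree : ∀ {P} → Fm P true → Fm P true
disagree B = or (and (mem 0 v0) (~ B)) (and (nmem 0 v0) B)

-- Δ assumes X₀ = {x | B[x, σ]}.
Comprehends : ∀ {P} → Sub → Fm P true → List (Fm P true) → Set
Comprehends σ B Δ = ex (fsub (liftS σ) (disagree B)) ∈ Δ

Comprehends-here : ∀ {P} {B : Fm P true} {Δ} → ex (disagree B) ∈ Δ → Comprehends tvar B Δ
Comprehends-here {B = B} = ∈-resp-≡ (cong ex (sym (trans (fsub-ext liftS-id (disagree B)) (fsub-id (disagree B)))))

Comprehends-ext : ∀ {P} {B : Fm P true} {σ σ′ Δ} → (∀ i → σ i ≡ σ′ i) →
  Comprehends σ B Δ → Comprehends σ′ B Δ
Comprehends-ext {B = B} e = ∈-resp-≡ (cong ex (fsub-ext (liftS-ext e) (disagree B)))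

Comprehends-shift : ∀ {P} {B : Fm P true} {σ Δ} → Comprehends σ B Δ → Comprehends (tsub wkₛ ∘ σ) B (map shift Δ)
Comprehends-shift {B = B} {σ} c = ∈-resp-≡
  (cong ex (trans (fsub-fsub (liftS wkₛ) (liftS σ) (disagree B)) (fsub-ext (liftS-tsub wkₛ σ) (disagree B))))
  (∈-map⁺ shift c)

disagree-at : ∀ {P} σ (B : Fm P true) t → sub0 (fsub (liftS σ) (disagree B)) t
  ≡ or (and (mem 0 t) (~ fsub (t ∷ₛ σ) B)) (and (nmem 0 t) (fsub (t ∷ₛ σ) B))
disagree-at σ B t = trans (sub0-liftS σ (disagree B) t)
  (cong (λ A → or (and (mem 0 t) A) (and (nmem 0 t) (fsub (t ∷ₛ σ) B))) (fsub-~ (t ∷ₛ σ) B))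

comprehension-⊆ : ∀ {P Th σ Δ} {B : Fm P true} t → Comprehends σ B Δ →
  Der true Th (nmem 0 t ∷ fsub (t ∷ₛ σ) B ∷ Δ)
comprehension-⊆ {σ = σ} {B = B} t c =
  exR (↑² c) t (cast-head (disagree-at σ B t) (orR #0 (andR #0 (axm #0 #4) (axm #5 #0))))

comprehension-⊇ : ∀ {P Th σ Δ} {B : Fm P true} t → Comprehends σ B Δ →
  Der true Th (~ fsub (t ∷ₛ σ) B ∷ mem 0 t ∷ Δ)
comprehension-⊇ {σ = σ} {B = B} t c =
  exR (↑² c) t (cast-head (disagree-at σ B t) (orR #0 (andR #1 (axm #5 #0) (axm #0 #4))))

comprehension-⊆-fresh : ∀ {P Th Δ} {B : Fm P true} → Comprehends wkₛ B Δ → Der true Th (nmem 0 v0 ∷ B ∷ Δ)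
comprehension-⊆-fresh {B = B} c = subst (λ A → Der _ _ (_ ∷ A ∷ _)) (fsub-v0∷wkₛ B) (comprehension-⊆ v0 c)

comprehension-⊇-fresh : ∀ {P Th Δ} {B : Fm P true} → Comprehends wkₛ B Δ → Der true Th (~ B ∷ mem 0 v0 ∷ Δ)
comprehension-⊇-fresh {B = B} c = cast-head (cong ~_ (sym (fsub-v0∷wkₛ B))) (comprehension-⊇ v0 c)

progressive⇒closed : ∀ {Th Δ} (q : OpForm) (B : Fm OpForm true) → Comprehends tvar B Δ →
  Der true Th (~ all (or (~ fill (ψ-at B) 0 (proj₁ q)) B) ∷ Cl (proj₁ q) ∷ Δ)
progressive⇒closed q B c =
  allR #1 (orR #0 (exR-fresh #3 (andR #0
    (cast-head (~-involutive (fill (ψ-at B) 0 φ))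
      (contract₀ ~φX (fill-monotone (λ _ → mem 0) (ψ-at B) (λ k → Comprehends (paramsUnder k) B)
        shift-params (λ t → comprehension-⊆ t) φ (positive-op q) c₀)))
    (contract₁ #2 (comprehension-⊇-fresh c′)))))
  where
  φ = proj₁ q
  c′ = ↑⁶ (Comprehends-shift c)
  c₀ = Comprehends-ext (λ i → cong (tvar ∘ suc) (sym (+-identityʳ i))) c′
  ~φX = ∈-resp-≡ (cong ~_ (embX-fill 0 φ)) #1
  shift-params : ∀ {k Δ} → Comprehends (paramsUnder k) B Δ → Comprehends (paramsUnder (suc k)) B (map shift Δ)
  shift-params {k} c = Comprehends-ext (λ i → cong (tvar ∘ suc) (sym (+-suc i k))) (Comprehends-shift c)

ind-base : ∀ {P Th Δ} {B : Fm P true} → Comprehends tvar B Δ → ~ sub0 B tzero ∈ Δ → Der true Th (mem 0 tzero ∷ Δ)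
ind-base c m = contract₀ m (comprehension-⊇ tzero c)

ind-step : ∀ {P Th Δ} {B : Fm P true} → Comprehends tvar B Δ → ex (and B (~ fsub (tsuc v0 ∷ₛ wkₛ) B)) ∈ Δ →
  Der true Th (all (or (nmem 0 v0) (mem 0 (tsuc v0))) ∷ Δ)
ind-step c m = allR #0 (orR #0 (exR-fresh (↑⁴ (∈-map⁺ shift m))
  (andR #0 (contract₀ #1 (comprehension-⊆-fresh c′)) (contract₁ #2 (comprehension-⊇ (tsuc v0) c′)))))
  where
  c′ = ↑⁵ (Comprehends-shift c)

ind-end : ∀ {P Th Δ} {B : Fm P true} → Comprehends tvar B Δ → all B ∈ Δ → Der true Th (ex (nmem 0 v0) ∷ Δ)
ind-end c m = allR (there m) (exR #1 v0 (comprehension-⊆-fresh (there (Comprehends-shift c))))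

LF-hypotheses : List OpForm → ℕ → List (Fm OpForm true)
LF-hypotheses [] n = []
LF-hypotheses (q ∷ qs) n = ~ LF[ q ] (sv n) ∷ LF-hypotheses qs (suc n)

LF-hypotheses-∈ : ∀ {q qs} (p : q ∈ qs) n → ~ LF[ q ] (sv (n + toℕ (index p))) ∈ LF-hypotheses qs n
LF-hypotheses-∈ {q} (here refl) n = here (cong (λ k → ~ LF[ q ] (sv k)) (+-identityʳ n))
LF-hypotheses-∈ {q} (there p) n =
  there (∈-resp-≡ (cong (λ k → ~ LF[ q ] (sv k)) (sym (+-suc n (toℕ (index p))))) (LF-hypotheses-∈ p (suc n)))

shift²-LF-hypotheses : ∀ qs n → map shift² (LF-hypotheses qs n) ≡ LF-hypotheses qs (suc n)
shift²-LF-hypotheses [] n = refl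
shift²-LF-hypotheses (q ∷ qs) n =
  cong₂ _∷_ (trans (ssub-~ wkˢ (LF[ q ] (sv n))) (cong ~_ (ssub-LF q (sv n) wkˢ))) (shift²-LF-hypotheses qs (suc n))

usedOps : ∀ {Γ} → Der false ID1Ax Γ → List OpForm
usedOps (axm _ _) = []
usedOps (thy (id-F q) _) = q ∷ []
usedOps (thy (id-L q _) _) = q ∷ []
usedOps (thy _ _) = []
usedOps (andR _ d e) = usedOps d ++ usedOps e
usedOps (orR _ d) = usedOps d
usedOps (allR _ d) = usedOps d
usedOps (exR _ _ d) = usedOps d
usedOps (cut _ d e) = usedOps d ++ usedOps e

module Translation {Th : Fm OpForm true → Set} (pi11 : ∀ {A} → Pi11CA0mAx A → Th A) where

  Ctx : Set
  Ctx = List (Fm OpForm true)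

  ⊢_ : Ctx → Set₁
  ⊢ Γ = Der true Th Γ

  -- A sequent containing ~ A has A as a hypothesis; LF_q(V) is either such a hypothesis or,
  -- when V = Y_q, an axiom.
  LFAssumed : OpForm → SV OpForm → Ctx → Set
  LFAssumed q V Γ = (V ≡ sc q × Th (LF q)) ⊎ (~ LF[ q ] V ∈ Γ)

  LFAssumed-⊆ : ∀ {q V Γ Δ} → Γ ⊆ Δ → LFAssumed q V Γ → LFAssumed q V Δ
  LFAssumed-⊆ s (inj₁ ax) = inj₁ ax
  LFAssumed-⊆ s (inj₂ m) = inj₂ (s m)

  LFAssumed-shift : ∀ {q V Γ} → LFAssumed q V Γ → LFAssumed q V (map shift Γ)
  LFAssumed-shift (inj₁ ax) = inj₁ ax
  LFAssumed-shift {q} {V} (inj₂ m) =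
    inj₂ (∈-resp-≡ (trans (fsub-~ wkₛ (LF[ q ] V)) (cong ~_ (fsub-LF q V wkₛ))) (∈-map⁺ shift m))

  LFAssumed-shift² : ∀ {q V Γ} → LFAssumed q V Γ → LFAssumed q (ssubSV wkˢ V) (map shift² Γ)
  LFAssumed-shift² (inj₁ (e , ax)) = inj₁ (cong (ssubSV wkˢ) e , ax)
  LFAssumed-shift² {q} {V} (inj₂ m) =
    inj₂ (∈-resp-≡ (trans (ssub-~ wkˢ (LF[ q ] V)) (cong ~_ (ssub-LF q V wkˢ))) (∈-map⁺ shift² m))

  assumeLF : ∀ {q V Γ} → LFAssumed q V Γ → ⊢ (~ LF[ q ] V ∷ Γ) → ⊢ Γ
  assumeLF {q} (inj₁ (e , ax)) d = cut (LF[ q ] _) (thy (subst (λ V → Th (LF[ q ] V)) (sym e) ax) #0) d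
  assumeLF (inj₂ m) d = contract m d

  LF-∈⇒inAllClosed : ∀ {q V Δ} t → LFAssumed q V Δ → ⊢ (~ memSV V t ∷ inAllClosed q t ∷ Δ)
  LF-∈⇒inAllClosed {q} {V} t h = assumeLF (LFAssumed-⊆ ↑² h)
    (exR #0 t (cast-head (~LF-instance q V t) (orR #0 (andR #0 (axm #0 #5) (axm #6 #0)))))

  LF-inAllClosed⇒∈ : ∀ {q V Δ} t → LFAssumed q V Δ → ⊢ (~ inAllClosed q t ∷ memSV V t ∷ Δ)
  LF-inAllClosed⇒∈ {q} {V} t h = assumeLF (LFAssumed-⊆ ↑² h)
    (exR #0 t (cast-head (~LF-instance q V t) (orR #0 (andR #1 (axm #6 #0) (axm #0 #5)))))

  inAllClosed-elim : ∀ {q Δ} t → ~ Cl (proj₁ q) ∈ Δ → ⊢ (~ inAllClosed q t ∷ mem 0 t ∷ Δ)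
  inAllClosed-elim {q} t m = ex²R #0 (sv 0) (cast-head body-at-X (andR #0 (axm #0 (↑⁴ m)) (axm #3 #0)))
    where
    body-at-X : sub0² (and (~ (~ Cl (proj₁ q))) (nmem 0 t)) (sv 0) ≡ and (Cl (proj₁ q)) (nmem 0 t)
    body-at-X = cong (λ A → and A (nmem 0 t))
      (trans (cong (λ A → sub0² A (sv 0)) (~-involutive (Cl (proj₁ q)))) (ssub-Cl q _ refl))

  V⊆closed : ∀ {q V Δ} t → LFAssumed q V Δ → ~ Cl (proj₁ q) ∈ Δ → ⊢ (~ memSV V t ∷ mem 0 t ∷ Δ)
  V⊆closed {q} t h c = chain (LF-∈⇒inAllClosed {q} t h) (inAllClosed-elim {q} t c)

  ~Cl-shift : ∀ {q Δ} → ~ Cl (proj₁ q) ∈ Δ → ~ Cl (proj₁ q) ∈ map shift Δ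
  ~Cl-shift {q} m = ∈-resp-≡ (trans (fsub-~ wkₛ (Cl (proj₁ q))) (cong ~_ (fsub-Cl q wkₛ))) (∈-map⁺ shift m)

  φ-into-closed : ∀ ρ {q Δ} → LFAssumed q (ρ q) Δ → ~ Cl (proj₁ q) ∈ Δ →
    ~ star[ ρ ] toI q (proj₁ q) ∈ Δ → ⊢ (embX (proj₁ q) ∷ Δ)
  φ-into-closed ρ {q} h c m = contract₀ m
    (subst₂ (λ A B → ⊢ (~ A ∷ B ∷ _)) (sym (star-toI ρ q 0 φ)) (sym (embX-fill 0 φ))
      (fill-monotone (λ _ → memSV (ρ q)) (λ _ → mem 0) (λ _ Δ → LFAssumed q (ρ q) Δ × ~ Cl φ ∈ Δ)
        (λ (h , c) → LFAssumed-shift h , ~Cl-shift {q} c) (λ t (h , c) → V⊆closed t h c)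
        φ (positive-op q) (h , c)))
    where
    φ = proj₁ q

  φ⇒inAllClosed : ∀ ρ {q Δ} → LFAssumed q (ρ q) Δ → ⊢ (~ star[ ρ ] toI q (proj₁ q) ∷ inAllClosed q v0 ∷ Δ)
  φ⇒inAllClosed ρ {q} h =
    all²R #1 (orR #0 (exR #0 v0 (cast-head ~Cl-at-v0 (andR #0 (φ-into-closed (ssubSV wkˢ ∘ ρ) h′ #1 φV′) (axm #3 #0)))))
    where
    φ = proj₁ q
    h′ = LFAssumed-⊆ (λ p → ↑⁶ p) (LFAssumed-shift² h)
    φV′ = ∈-resp-≡ (trans (ssub-~ wkˢ (star[ ρ ] toI q φ)) (cong ~_ (ssub-star ρ wkˢ (toI q φ)))) #4
    fixes0 : FixesBelow 1 (v0 ∷ₛ tvar)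
    fixes0 zero _ = refl
    ~Cl-at-v0 : sub0 (and (~ (~ embX φ)) (nmem 0 v0)) v0 ≡ and (embX φ) (nmem 0 v0)
    ~Cl-at-v0 = cong (λ A → and A (nmem 0 v0))
      (trans (cong (fsub (v0 ∷ₛ tvar)) (~-involutive (embX φ))) (fsub-embX-fixesBelow φ (fmBelow-op q) fixes0))

  axiom-F : ∀ {ρ q Γ} → LFAssumed q (ρ q) Γ → star[ ρ ] F-axiom q ∈ Γ → ⊢ Γ
  axiom-F {ρ} {q} h m = allR m (orR #0 (cast-head (star-~ ρ (toI q (proj₁ q)))
    (chain (φ⇒inAllClosed ρ h′) (LF-inAllClosed⇒∈ v0 h′))))
    where
    h′ = LFAssumed-⊆ there (LFAssumed-shift h)

  comprehension-cut : ∀ {Γ} B → T (arith B) → ⊢ (ex (disagree (shift² B)) ∷ map shift² Γ) → ⊢ Γ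
  comprehension-cut B ar d = cut (compr B) (thy (pi11 (pi-aca (aca-ca B ar))) #0)
    (all²R #0 (cast-head ~iff≡disagree (weaken d (∷⁺ʳ _ there))))
    where
    ~iff≡disagree : ~ all (and (or (nmem 0 v0) (shift² B)) (or (mem 0 v0) (~ shift² B))) ≡ ex (disagree (shift² B))
    ~iff≡disagree = cong (λ A → ex (or (and (mem 0 v0) (~ shift² B)) (and (nmem 0 v0) A))) (~-involutive (shift² B))

  with-comprehension : ∀ ρ A {Γ} → ⊢ (ex (disagree (star[ ssubSV wkˢ ∘ ρ ] A)) ∷ map shift² Γ) → ⊢ Γ
  with-comprehension ρ A d =
    comprehension-cut (star[ ρ ] A) (arith-star ρ A) (cast-head (cong (ex ∘ disagree) (ssub-star ρ wkˢ A)) d)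

  closed⇒below : ∀ {q V Δ} B → LFAssumed q V Δ → Comprehends tvar B Δ →
    ⊢ (~ Cl (proj₁ q) ∷ all (or (nmemSV V v0) B) ∷ Δ)
  closed⇒below {q} {V} B h c = allR #1 (orR #0 (cast-head (sym (~-memSV V v0))
    (chain (V⊆closed v0 (LFAssumed-⊆ (λ p → ↑³ p) (LFAssumed-shift h)) (there (~Cl-shift {q} #0)))
           (comprehension-⊆-fresh (↑³ (Comprehends-shift c))))))

  axiom-L : ∀ {ρ q ψ Γ} → LFAssumed q (ρ q) Γ → star[ ρ ] L-axiom q ψ ∈ Γ → ⊢ Γ
  axiom-L {ρ} {q} {ψ} h m = with-comprehension ρ ψ
    (orR (there (∈-resp-≡ star-L (∈-map⁺ shift² m)))
      (chain (progressive⇒closed q ψ⋆ c) (closed⇒below ψ⋆ (LFAssumed-⊆ there (LFAssumed-shift² h)) c)))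
    where
    φ = proj₁ q
    ρ′ = ssubSV wkˢ ∘ ρ
    ψ⋆ = star[ ρ′ ] ψ
    c = Comprehends-here #0
    star-L : shift² (star[ ρ ] L-axiom q ψ)
      ≡ or (~ all (or (~ fill (ψ-at ψ⋆) 0 φ) ψ⋆)) (all (or (nmemSV (ρ′ q) v0) ψ⋆))
    star-L = trans (ssub-star ρ wkˢ (L-axiom q ψ)) (cong (λ A → or A (all (or (nmemSV (ρ′ q) v0) ψ⋆)))
      (trans (star-~ ρ′ (all (or (~ plug 0 φ ψ) ψ)))
        (cong (λ A → ~ all (or A ψ⋆)) (trans (star-~ ρ′ (plug 0 φ ψ)) (cong ~_ (star-plug ρ′ 0 φ ψ))))))

  set-induction : Fm OpForm true
  set-induction = all² (or (nmem 0 tzero) (or (ex (and (mem 0 v0) (nmem 0 (tsuc v0)))) (all (mem 0 v0))))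

  induction-by-comprehension : ∀ {B Δ} → Comprehends tvar B Δ → induction-instance B ∈ Δ → ⊢ Δ
  induction-by-comprehension c m =
    orR m (orR #1 (cut set-induction (thy (pi11 (pi-aca aca-ind)) #0)
      (ex²R #0 (sv 0) (andR #0 (ind-base (↑⁶ c) #4)
                               (andR #0 (ind-step (↑⁷ c) #3) (ind-end (↑⁷ c) #4))))))

  axiom-induction : ∀ {ρ A Γ} → star[ ρ ] induction-instance A ∈ Γ → ⊢ Γ
  axiom-induction {ρ} {A} m = with-comprehension ρ A (induction-by-comprehension (Comprehends-here #0)
    (there (∈-resp-≡ (trans (ssub-star ρ wkˢ (induction-instance A)) (star-induction (ssubSV wkˢ ∘ ρ) A))
                     (∈-map⁺ shift² m))))

  translate : ∀ {Γ} (d : Der false ID1Ax Γ) ρ {Δ} → map (star[ ρ ]_) Γ ⊆ Δ →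
    (∀ q → q ∈ usedOps d → LFAssumed q (ρ q) Δ) → ⊢ Δ
  translate (axm {A = A} p p′) ρ s h = axm (s (∈-map⁺ _ p)) (∈-resp-≡ (star-~ ρ A) (s (∈-map⁺ _ p′)))
  translate (thy (id-eq ax) p) ρ s h = thy (pi11 (pi-aca (aca-eq (star-EqAx ρ ax)))) (s (∈-map⁺ _ p))
  translate (thy (id-pa ax) p) ρ s h = thy (pi11 (pi-aca (aca-pa (star-PABasic ρ ax)))) (s (∈-map⁺ _ p))
  translate (thy (id-ind (ind A)) p) ρ s h = axiom-induction {ρ} {A} (s (∈-map⁺ _ p))
  translate (thy (id-F q) p) ρ s h = axiom-F (h q #0) (s (∈-map⁺ _ p))
  translate (thy (id-L q ψ) p) ρ s h = axiom-L (h q #0) (s (∈-map⁺ _ p))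
  translate (andR p d e) ρ s h = andR (s (∈-map⁺ _ p))
    (translate d ρ (∷⁺ʳ _ s) (λ q → LFAssumed-⊆ there ∘ h q ∘ ∈-++⁺ˡ))
    (translate e ρ (∷⁺ʳ _ s) (λ q → LFAssumed-⊆ there ∘ h q ∘ ∈-++⁺ʳ (usedOps d)))
  translate (orR p d) ρ s h = orR (s (∈-map⁺ _ p))
    (translate d ρ (∷⁺ʳ _ (∷⁺ʳ _ s)) (λ q → LFAssumed-⊆ (λ m → ↑² m) ∘ h q))
  translate (allR {Γ = Γ} p d) ρ s h = allR (s (∈-map⁺ _ p))
    (translate d ρ (∷⁺ʳ _ (subst (_⊆ _) (sym (star-shift ρ Γ)) (map⁺ shift s)))
                   (λ q → LFAssumed-⊆ there ∘ LFAssumed-shift ∘ h q))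
  translate (exR {A = A} p t d) ρ s h = exR (s (∈-map⁺ _ p)) t
    (cast-head (sym (star-fsub ρ (t ∷ₛ tvar) A)) (translate d ρ (∷⁺ʳ _ s) (λ q → LFAssumed-⊆ there ∘ h q)))
  translate (cut A d e) ρ s h = cut (star[ ρ ] A)
    (translate d ρ (∷⁺ʳ _ s) (λ q → LFAssumed-⊆ there ∘ h q ∘ ∈-++⁺ˡ))
    (cast-head (sym (star-~ ρ A))
      (translate e ρ (∷⁺ʳ _ s) (λ q → LFAssumed-⊆ there ∘ h q ∘ ∈-++⁺ʳ (usedOps d))))

  -- Π¹₁-comprehension for ∀X (Cl_φ(X) → x ∈ X); Cl_φ has no set parameters.
  LF-exists : ∀ q {Γ} → ⊢ (ex² (LF[ q ] (sv 0)) ∷ Γ)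
  LF-exists q = thy (pi11 (pi-ca θ θ-Π¹₁)) (∈-resp-≡ (sym compr≡LF) #0)
    where
    θ = or (~ Cl (proj₁ q)) (mem 0 v0)
    θ-Π¹₁ : T (arith θ ∧ noFreeSet 1 θ)
    θ-Π¹₁ = T-∧⁺ (T-∧⁺ (arith-~Cl (proj₁ q)) tt) (T-∧⁺ (noFreeSet-~Cl (proj₁ q)) tt)
    compr≡LF : compr (all² θ) ≡ ex² (LF[ q ] (sv 0))
    compr≡LF = cong (λ G → ex² (all (and (or (nmem 0 v0) G) (or (mem 0 v0) (~ G))))) (ssub-inAllClosed q wkˢ v0)

  discharge : ∀ {X} → shift² X ≡ X → ∀ qs → ⊢ (X ∷ LF-hypotheses qs 0) → ⊢ (X ∷ [])
  discharge e [] d = d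
  discharge e (q ∷ qs) d = discharge e qs (cut (ex² (LF[ q ] (sv 0))) (LF-exists q) (all²R #0 (weaken d
    λ { #0 → ∈-resp-≡ e #2 ; #1 → #0 ; (↑² p) → ↑³ (subst (_ ∈_) (sym (shift²-LF-hypotheses qs 0)) p) })))

-- Y_φ for φ occurring in ψ, otherwise the variable whose LF-hypothesis sits at φ's position in qs;
-- the last case is never used.
assignment : Fm OpForm false → List OpForm → Assignment
assignment ψ qs q with occ? q ψ | q ∈? qs
... | yes _ | _ = sc q
... | no _ | yes p = sv (toℕ (index p))
... | no _ | no _ = sc q

assignment-occurring : ∀ ψ qs q → Occ q ψ → assignment ψ qs q ≡ sc q
assignment-occurring ψ qs q o with occ? q ψ | q ∈? qs
... | yes _ | _ = refl
... | no ¬o | _ = ⊥-elim (¬o o)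

proposition4p3 : (ψ : Fm OpForm false) →
    Der false ID1Ax (ψ ∷ []) → Der true (TargetAx ψ) (star ψ ∷ [])
proposition4p3 ψ d = discharge (shift²-star ψ) qs
  (cast-head (sym (star-occurring ρ ψ (assignment-occurring ψ qs))) (translate d ρ (λ { #0 → #0 }) LF-available))
  where
  open Translation {TargetAx ψ} t-base
  qs = usedOps d
  ρ = assignment ψ qs
  LF-available : ∀ q → q ∈ qs → LFAssumed q (ρ q) (star[ ρ ] ψ ∷ LF-hypotheses qs 0)
  LF-available q q∈qs with occ? q ψ | q ∈? qs
  ... | yes o | _ = inj₁ (refl , t-LF q o)
  ... | no _ | yes p = inj₂ (there (LF-hypotheses-∈ p 0))
  ... | no _ | no q∉qs = ⊥-elim (q∉qs q∈qs)
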